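{- Let $\phi$ be the morphism on $\{0,1\}$ given by $\phi(0)=001$, $\phi(1)=1$, and let $\mathbf{x}=\phi^{\omega}(0)$. Then $\operatorname{nsc}_{\mathbf{x}}(n)<2n$ for all $n\ge1$.
   Context: $\phi^{\omega}(0)$ denotes the infinite fixed point of $\phi$ beginning with $0$. For an infinite word $\mathbf{x}=x_0x_1x_2\cdots$ (indexed from $0$) and $n\ge1$, $\operatorname{nsc}_{\mathbf{x}}(n)=\max\{m\in\mathbb{N}: x_i\cdots x_{i+n-1}\neq x_j\cdots x_{j+n-1}\text{ for all } 0\le i<j\le m-1\}$. -}

module Defs where

open import Data.Nat using (ℕ; zero; suc; _+_; _≤_; _<_)
open import Data.Bool using (Bool; true; false)
open import Data.List using (List; []; _∷_; _++_; concatMap)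
open import Data.Product using (Σ; _×_)
open import Relation.Binary.PropositionalEquality using (_≡_)
open import Relation.Nullary using (¬_)

-- Alphabet {0,1} encoded as Bool: false = 0, true = 1.

φ : Bool → List Bool
φ false = false ∷ false ∷ true ∷ []
φ true  = true ∷ []

φ* : List Bool → List Bool
φ* = concatMap φ

φ^_[0] : ℕ → List Bool
φ^ zero [0] = false ∷ []
φ^ suc k [0] = φ* (φ^ k [0])

-- total list indexing with default letter 0 (only used in-range below)
nth : List Bool → ℕ → Bool
nth []       _       = false
nth (a ∷ w)  zero    = a
nth (a ∷ w)  (suc i) = nth w i

-- Since φ(0) begins with 0, each φ^k(0) is a prefix of φ^(k+1)(0), and
-- |φ^k(0)| ≥ k+1, so the letter at position i is the i-th letter of φ^(i+1)(0).
x : ℕ → Bool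
x i = nth (φ^ suc i [0]) i

SameFactor : (ℕ → Bool) → ℕ → ℕ → ℕ → Set
SameFactor w n i j = ∀ k → k < n → w (i + k) ≡ w (j + k)

DistinctUpTo : (ℕ → Bool) → ℕ → ℕ → Set
DistinctUpTo w n m = ∀ i j → i < j → suc j ≤ m → ¬ SameFactor w n i j

IsNsc : (ℕ → Bool) → ℕ → ℕ → Set
IsNsc w n m = DistinctUpTo w n m × (∀ m′ → DistinctUpTo w n m′ → m′ ≤ m)

module Submission where

-- Let W k = φ^k(0) and x = φ^ω(0).  Since φ(0) = 001 and φ(1) = 1, the
-- finite words satisfy W (k+1) = W k · W k · 1, so their lengths are
-- L 0 = 1 and L (k+1) = 2 L k + 1, and every W k is a prefix of x.
-- Consequently x begins with W k · W k, i.e. the factors of length n ≤ L k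
-- at positions 0 and L k coincide.  Choosing k with n ≤ L k < 2n (such k
-- exists for every n ≥ 1 because L (k+1) = 2 L k + 1) gives a repetition
-- at position L k < 2n.
--
-- Independently of the word, a repetition of a length-n factor at position
-- j forces nsc(n) to exist and to be at most j: nsc(n) is the least position
-- at which some earlier length-n factor reappears, and that least position
-- can be found because equality of finite factors over {0,1} is decidable.

open import Defs
open import Data.Nat using (ℕ; _≤_; _<_; _*_)
open import Data.Product using (Σ; _×_)
open import Data.Nat using (zero; suc; _+_; z≤n; s≤s; _≤′_; ≤′-refl; ≤′-step)
open import Data.Nat.Properties
open import Data.Nat.Induction using (<-rec)
open import Data.Bool using (Bool; true)
import Data.Bool.Properties as Bool
open import Data.List using (List; []; _∷_; _++_; length)
open import Data.List.Properties using (++-assoc; ++-identityʳ; length-++)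
open import Data.Product using (∃; _,_)
open import Data.Sum using (inj₁; inj₂)
open import Relation.Nullary using (¬_; Dec; yes; no; contradiction)
open import Relation.Nullary.Decidable using (map′)
open import Relation.Unary using (Decidable)
open import Relation.Binary.PropositionalEquality

module _ {P : ℕ → Set} (P? : Decidable P) where

  record LeastBelow (j : ℕ) : Set where
    constructor least
    field
      value   : ℕ
      bounded : value ≤ j
      holds   : P value
      minimal : ∀ i → i < value → ¬ P i

  leastWitness : ∀ j → P j → LeastBelow j
  leastWitness = <-rec (λ j → P j → LeastBelow j) improve
    where
    improve : ∀ j → (∀ {i} → i < j → P i → LeastBelow i) → P j → LeastBelow j
    improve j rec Pj with anyUpTo? P? j
    ... | no none = least j ≤-refl Pj (λ i i<j Pi → none (i , i<j , Pi))
    ... | yes (i , i<j , Pi) with rec i<j Pi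
    ...   | least m m≤i Pm min = least m (≤-trans m≤i (<⇒≤ i<j)) Pm min

Repeats : (ℕ → Bool) → ℕ → ℕ → Set
Repeats w n j = ∃ λ i → i < j × SameFactor w n i j

sameFactor? : ∀ w n i j → Dec (SameFactor w n i j)
sameFactor? w n i j =
  map′ (λ all k → all {k}) (λ all {k} → all k)
       (allUpTo? (λ k → w (i + k) Bool.≟ w (j + k)) n)

repeats? : ∀ w n → Decidable (Repeats w n)
repeats? w n j = anyUpTo? (λ i → sameFactor? w n i j) j

firstRepeat-isNsc : ∀ w n m → Repeats w n m → (∀ j → j < m → ¬ Repeats w n j)
                  → IsNsc w n m
firstRepeat-isNsc w n m (i , i<m , same) first = distinct , maximal
  where
  distinct : DistinctUpTo w n m
  distinct i′ j i′<j j<m same′ = first j j<m (i′ , i′<j , same′)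

  maximal : ∀ m′ → DistinctUpTo w n m′ → m′ ≤ m
  maximal m′ distinct′ with m′ ≤? m
  ... | yes m′≤m = m′≤m
  ... | no m′≰m = contradiction same (distinct′ i m i<m (≰⇒> m′≰m))

nsc-≤-repetition : ∀ w n i j → i < j → SameFactor w n i j
                 → Σ ℕ (λ m → IsNsc w n m × m ≤ j)
nsc-≤-repetition w n i j i<j same
  with leastWitness (repeats? w n) j (i , i<j , same)
... | least m m≤j rep first = m , firstRepeat-isNsc w n m rep first , m≤j

W : ℕ → List Bool
W k = φ^ k [0]

L : ℕ → ℕ
L zero    = 1
L (suc k) = suc (L k + L k)

φ*-++ : ∀ u v → φ* (u ++ v) ≡ φ* u ++ φ* v
φ*-++ []      v = refl
φ*-++ (a ∷ u) v = trans (cong (φ a ++_) (φ*-++ u v)) (sym (++-assoc (φ a) (φ* u) (φ* v)))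

W-suc : ∀ k → W (suc k) ≡ W k ++ W k ++ true ∷ []
W-suc zero    = refl
W-suc (suc k) = begin
  φ* (W (suc k))                             ≡⟨ cong φ* (W-suc k) ⟩
  φ* (W k ++ W k ++ true ∷ [])               ≡⟨ φ*-++ (W k) _ ⟩
  W (suc k) ++ φ* (W k ++ true ∷ [])         ≡⟨ cong (W (suc k) ++_) (φ*-++ (W k) _) ⟩
  W (suc k) ++ W (suc k) ++ true ∷ []        ∎
  where open ≡-Reasoning

length-W : ∀ k → length (W k) ≡ L k
length-W zero    = refl
length-W (suc k) = begin
  length (W (suc k))                         ≡⟨ cong length (W-suc k) ⟩
  length (W k ++ W k ++ true ∷ [])           ≡⟨ length-++ (W k) ⟩
  length (W k) + length (W k ++ true ∷ [])   ≡⟨ cong (length (W k) +_) (length-++ (W k)) ⟩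
  length (W k) + (length (W k) + 1)          ≡⟨ cong₂ (λ a b → a + (b + 1)) (length-W k) (length-W k) ⟩
  L k + (L k + 1)                            ≡⟨ cong (L k +_) (+-comm (L k) 1) ⟩
  L k + suc (L k)                            ≡⟨ +-suc (L k) (L k) ⟩
  L (suc k)                                  ∎
  where open ≡-Reasoning

-- φ^k(0) has more than k letters; ensures x i is read inside φ^(i+1)(0).
L-> : ∀ k → k < L k
L-> zero    = s≤s z≤n
L-> (suc k) = s≤s (≤-trans (L-> k) (m≤m+n (L k) (L k)))

nth-++ˡ : ∀ u v i → i < length u → nth (u ++ v) i ≡ nth u i
nth-++ˡ (a ∷ u) v zero    _       = refl
nth-++ˡ (a ∷ u) v (suc i) (s≤s p) = nth-++ˡ u v i p

nth-++ʳ : ∀ u v i → nth (u ++ v) (length u + i) ≡ nth v i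
nth-++ʳ []      v i = refl
nth-++ʳ (a ∷ u) v i = nth-++ʳ u v i

W-prefix : ∀ {a b} → a ≤′ b → ∃ λ v → W b ≡ W a ++ v
W-prefix {a} ≤′-refl      = [] , sym (++-identityʳ (W a))
W-prefix {a} (≤′-step {b} a≤b) with W-prefix a≤b
... | v , Wb≡ = v ++ W b ++ true ∷ [] , (begin
  W (suc b)                                  ≡⟨ W-suc b ⟩
  W b ++ W b ++ true ∷ []                    ≡⟨ cong (_++ W b ++ true ∷ []) Wb≡ ⟩
  (W a ++ v) ++ W b ++ true ∷ []             ≡⟨ ++-assoc (W a) v _ ⟩
  W a ++ v ++ W b ++ true ∷ []               ∎)
  where open ≡-Reasoning

W-stable : ∀ {a b} i → a ≤ b → i < L a → nth (W b) i ≡ nth (W a) i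
W-stable {a} i a≤b i<La with W-prefix (≤⇒≤′ a≤b)
... | v , Wb≡ = trans (cong (λ u → nth u i) Wb≡)
                      (nth-++ˡ (W a) v i (subst (i <_) (sym (length-W a)) i<La))

x-prefix : ∀ k i → i < L k → x i ≡ nth (W k) i
x-prefix k i i<Lk with ≤-total k (suc i)
... | inj₁ k≤1+i = W-stable i k≤1+i i<Lk
... | inj₂ 1+i≤k = sym (W-stable i 1+i≤k (<-trans (n<1+n i) (L-> (suc i))))

x-square : ∀ k t → t < L k → x t ≡ x (L k + t)
x-square k t t<Lk = begin
  x t                                        ≡⟨ x-prefix k t t<Lk ⟩
  nth (W k) t                                ≡⟨ sym (nth-++ˡ (W k) (true ∷ []) t t<|Wk|) ⟩
  nth (W k ++ true ∷ []) t                   ≡⟨ sym (nth-++ʳ (W k) _ t) ⟩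
  nth (W k ++ W k ++ true ∷ []) (length (W k) + t)
                                             ≡⟨ cong₂ (λ u p → nth u (p + t)) (sym (W-suc k)) (length-W k) ⟩
  nth (W (suc k)) (L k + t)                  ≡⟨ sym (x-prefix (suc k) (L k + t) second-half) ⟩
  x (L k + t)                                ∎
  where
  open ≡-Reasoning
  t<|Wk| : t < length (W k)
  t<|Wk| = subst (t <_) (sym (length-W k)) t<Lk
  second-half : L k + t < L (suc k)
  second-half = s≤s (+-monoʳ-≤ (L k) (<⇒≤ t<Lk))

repetition-at-L : ∀ k n → n ≤ L k → SameFactor x n 0 (L k)
repetition-at-L k n n≤Lk t t<n = x-square k t (<-≤-trans t<n n≤Lk)

-- Every n ≥ 1 satisfies n ≤ L k < 2n for some k.  Induction on n: either the window for n still works for n + 1, or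
-- n = L k and then L (k+1) = 2n + 1 is the window for n + 1.
window : ∀ n → 1 ≤ n → Σ ℕ (λ k → n ≤ L k × L k < n + n)
window (suc zero)    _ = 0 , ≤-refl , ≤-refl
window (suc (suc n)) _ with window (suc n) (s≤s z≤n)
... | k , n≤Lk , Lk<2n with m≤n⇒m<n∨m≡n n≤Lk
...   | inj₁ n<Lk = k , n<Lk , <-≤-trans Lk<2n (+-mono-≤ (n≤1+n (suc n)) (n≤1+n (suc n)))
...   | inj₂ 1+n≡Lk =
        suc k
      , subst (λ l → suc (suc n) ≤ suc (l + l)) 1+n≡Lk (s≤s (s≤s (m≤m+n n _)))
      , subst (λ l → suc (l + l) < suc (suc n) + suc (suc n)) 1+n≡Lk
              (s≤s (s≤s (+-monoʳ-< n (n<1+n (suc n)))))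

mainTheorem6 : (n : ℕ) → 1 ≤ n → Σ ℕ (λ m → IsNsc x n m × m < 2 * n)
mainTheorem6 n 1≤n with window n 1≤n
... | k , n≤Lk , Lk<2n with nsc-≤-repetition x n 0 (L k) (<-≤-trans 1≤n n≤Lk) (repetition-at-L k n n≤Lk)
...   | m , isNsc , m≤Lk = m , isNsc , ≤-<-trans m≤Lk (subst (L k <_) twice Lk<2n)
  where
  twice : n + n ≡ 2 * n
  twice = cong (n +_) (sym (+-identityʳ n))
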